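{- Let $d\ge 2$, $n\ge d$ and $k\ge 1$ be integers, and put $c=\left\lceil n/\sum_{j=0}^k d^j\right\rceil$. Suppose one of the following holds: (i) $\sum_{j=0}^k d^j \mid n$ and $\gcd(d-1,n) \mid n/\sum_{j=0}^k d^j$; (ii) there is an integer $q$ with $c\equiv q \pmod{\gcd(d-1,n)}$ and $0\le q\sum_{j=0}^{k-1} d^j \le \big(\sum_{j=0}^k d^j\big)c - n$. Then $\gamma_k(G_B(n,d)) = c$, and there is a vertex $x$ of $G_B(n,d)$ such that $D=\{x,x+1,\dots,x+c-1\}$ (taken modulo $n$) is a minimum distance $k$-dominating set of $G_B(n,d)$.
   Context: The generalized de Bruijn digraph $G_B(n,d)$ has vertex set $\{0,1,\dots,n-1\}$ and an arc $(x,y)$ whenever $y\equiv dx+i \pmod n$ for some $0\le i\le d-1$ (self-loops allowed). A set $D\subseteq V(G)$ of a digraph $G$ is a distance $k$-dominating set if every vertex $v\notin D$ has some $u\in D$ with a directed path from $u$ to $v$ of length at most $k$. $\gamma_k(G)$ denotes the minimum cardinality of a distance $k$-dominating set of $G$. -}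

module Defs where

open import Data.Nat using (ℕ; zero; suc; _+_; _*_; _∸_; _^_; _≤_; _<_; NonZero; _/_; _%_)
open import Data.Nat.DivMod using (m%n<n)
open import Data.Fin using (Fin; toℕ; fromℕ<)
open import Data.Fin.Subset using (Subset; ⊥; ⁅_⁆; _∪_; _∈_; _∉_; ∣_∣)
open import Data.Product using (Σ; ∃; _×_; _,_)
open import Relation.Binary.PropositionalEquality using (_≡_)

geomTail : ℕ → ℕ → ℕ
geomTail d zero    = 0
geomTail d (suc k) = geomTail d k + d ^ suc k

-- Σ_{j=0}^{k} d^j  =  1 + Σ_{j=1}^{k} d^j  (written with suc so NonZero is automatic)
geomSum : ℕ → ℕ → ℕ
geomSum d k = suc (geomTail d k)

⌈_/_⌉ : ℕ → (b : ℕ) → .{{NonZero b}} → ℕ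
⌈ a / b ⌉ = (a + b ∸ 1) / b

Arc : (n d : ℕ) .{{_ : NonZero n}} → Fin n → Fin n → Set
Arc n d x y = ∃ λ i → i < d × toℕ y ≡ (d * toℕ x + i) % n

data Walk (n d : ℕ) .{{_ : NonZero n}} : ℕ → Fin n → Fin n → Set where
  here : ∀ {u} → Walk n d zero u u
  step : ∀ {m u w v} → Arc n d u w → Walk n d m w v → Walk n d (suc m) u v

IsDistDom : (n d : ℕ) .{{_ : NonZero n}} → ℕ → Subset n → Set
IsDistDom n d k D =
  ∀ v → v ∉ D → ∃ λ u → u ∈ D × ∃ λ m → m ≤ k × Walk n d m u v

IsMinDistDom : (n d : ℕ) .{{_ : NonZero n}} → ℕ → Subset n → Set
IsMinDistDom n d k D =
  IsDistDom n d k D × (∀ D′ → IsDistDom n d k D′ → ∣ D ∣ ≤ ∣ D′ ∣)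

DomNumberIs : (n d : ℕ) .{{_ : NonZero n}} → ℕ → ℕ → Set
DomNumberIs n d k γ =
  (∃ λ D → IsDistDom n d k D × ∣ D ∣ ≡ γ) ×
  (∀ D → IsDistDom n d k D → γ ≤ ∣ D ∣)

interval : (n : ℕ) .{{_ : NonZero n}} → Fin n → ℕ → Subset n
interval n x zero    = ⊥
interval n x (suc j) = interval n x j ∪ ⁅ fromℕ< (m%n<n (toℕ x + j) n) ⁆

-- Lower bound: from a vertex, the walks of length m reach at most d ^ m vertices, so a distance
-- k-dominating set D covers at most ∣ D ∣ * (1 + d + ⋯ + d ^ k) vertices, whence ∣ D ∣ ≥ c.
-- Upper bound: the vertices reached in exactly m steps from {x, …, x + c − 1} are d ^ m x + r
-- with r < c d ^ m. If (d − 1) x ≡ c − q (mod n), solvable by Bézout when gcd (d − 1, n) ∣ c − q,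
-- then d ^ m x + q R m ≡ x + c R m with R m = 1 + d + ⋯ + d ^ (m − 1), so layer m covers the
-- offsets x + t with c R m ≤ t + q R m < c R (m + 1). Consecutive layers overlap, layer 0 starts
-- at t = 0, and condition (ii) (with q = 0 under condition (i)) says layer k reaches past n.

module Submission where

open import Defs
open import Data.Nat
open import Data.Nat.Properties
open import Data.Nat.DivMod
open import Data.Nat.Divisibility using (_∣_; divides)
open import Data.Nat.GCD using (gcd; gcd-GCD; gcd[m,n]∣n; module Bézout)
open import Data.Integer as ℤ using (ℤ; +_; -[1+_]; _-_) renaming (_*_ to _*ℤ_; _≤_ to _≤ℤ_)
import Data.Integer.Properties as ℤ
open import Data.Integer.Divisibility using () renaming (_∣_ to _∣ℤ_)
import Data.Integer.Divisibility.Signed as Signed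
open import Data.Integer.Tactic.RingSolver using () renaming (solve-∀ to ℤ-solve-∀)
open import Data.Product using (∃; _×_; _,_)
open import Data.Sum using (_⊎_; inj₁; inj₂)
open import Data.Nat.Tactic.RingSolver using (solve-∀)
open import Data.Fin as Fin using (Fin; toℕ)
open import Data.Fin.Properties using (toℕ-fromℕ<; toℕ<n; toℕ-injective; injective⇒≤)
open import Data.Fin.Subset using (Subset; inside; outside; ∣_∣; ⁅_⁆; _∪_; _∈_; _∉_)
open import Data.Fin.Subset.Properties using (_∈?_; ∪-identityʳ; ∣⊥∣≡0; ∉⊥; x∈⁅x⁆; x∈⁅y⁆⇒x≡y; x∈p∪q⁺; x∈p∪q⁻)
open import Data.Vec using ([]; _∷_; here; there)
open import Data.List as List using (List; []; _∷_; _++_; map; length; applyUpTo; concatMap)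
open import Data.List.Properties using (length-map; length-++; length-applyUpTo)
open import Data.List.Membership.Propositional using (lose) renaming (_∈_ to _∈ₗ_)
open import Data.List.Membership.Propositional.Properties
  using (∈-map⁺; ∈-++⁺ˡ; ∈-++⁺ʳ; ∈-applyUpTo⁺; ∈-concatMap⁺)
import Data.List.Relation.Unary.Any as Any
open import Data.List.Relation.Unary.Any.Properties using (lookup-index)
open import Data.Empty using (⊥-elim)
open import Function using (_∘_)
open import Relation.Binary.PropositionalEquality
open import Relation.Nullary using (yes; no)

infix 4 _≡_[mod_]

_≡_[mod_] : ℕ → ℕ → (n : ℕ) → .{{NonZero n}} → Set
_≡_[mod_] a b n = a % n ≡ b % n

module Modular {n : ℕ} .{{_ : NonZero n}} where

  +-congʳ-mod : ∀ {a b} c → a ≡ b [mod n ] → a + c ≡ b + c [mod n ]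
  +-congʳ-mod {a} {b} c a≡b = begin
    (a + c) % n           ≡⟨ %-distribˡ-+ a c n ⟩
    (a % n + c % n) % n   ≡⟨ cong (λ z → (z + c % n) % n) a≡b ⟩
    (b % n + c % n) % n   ≡⟨ %-distribˡ-+ b c n ⟨
    (b + c) % n           ∎
    where open ≡-Reasoning

  +-congˡ-mod : ∀ c {a b} → a ≡ b [mod n ] → c + a ≡ c + b [mod n ]
  +-congˡ-mod c {a} {b} a≡b =
    subst₂ (λ x y → x ≡ y [mod n ]) (+-comm a c) (+-comm b c) (+-congʳ-mod c a≡b)

  *-congˡ-mod : ∀ c {a b} → a ≡ b [mod n ] → c * a ≡ c * b [mod n ]
  *-congˡ-mod c {a} {b} a≡b = begin
    (c * a) % n               ≡⟨ %-distribˡ-* c a n ⟩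
    (c % n * (a % n)) % n     ≡⟨ cong (λ z → (c % n * z) % n) a≡b ⟩
    (c % n * (b % n)) % n     ≡⟨ %-distribˡ-* c b n ⟨
    (c * b) % n               ∎
    where open ≡-Reasoning

  +-cancelʳ-mod : ∀ {a b} e → a + e ≡ b + e [mod n ] → a ≡ b [mod n ]
  +-cancelʳ-mod {a} {b} e h = begin
    a % n                       ≡⟨ complete a ⟨
    (a + e + (n ∸ e % n)) % n   ≡⟨ +-congʳ-mod (n ∸ e % n) h ⟩
    (b + e + (n ∸ e % n)) % n   ≡⟨ complete b ⟩
    b % n                       ∎
    where
    open ≡-Reasoning
    e+[n∸e%n]≡[1+e/n]*n : e + (n ∸ e % n) ≡ suc (e / n) * n
    e+[n∸e%n]≡[1+e/n]*n = begin
      e + (n ∸ e % n)                     ≡⟨ cong (_+ (n ∸ e % n)) e≡[e/n]*n+e%n ⟩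
      e / n * n + e % n + (n ∸ e % n)     ≡⟨ +-assoc (e / n * n) (e % n) (n ∸ e % n) ⟩
      e / n * n + (e % n + (n ∸ e % n))   ≡⟨ cong (_+_ (e / n * n)) (m+[n∸m]≡n (m%n≤n e n)) ⟩
      e / n * n + n                       ≡⟨ +-comm (e / n * n) n ⟩
      suc (e / n) * n                     ∎
      where
      e≡[e/n]*n+e%n : e ≡ e / n * n + e % n
      e≡[e/n]*n+e%n = trans (m≡m%n+[m/n]*n e n) (+-comm (e % n) (e / n * n))
    complete : ∀ x → (x + e + (n ∸ e % n)) % n ≡ x % n
    complete x = begin
      (x + e + (n ∸ e % n)) % n     ≡⟨ cong (_% n) (+-assoc x e (n ∸ e % n)) ⟩
      (x + (e + (n ∸ e % n))) % n   ≡⟨ cong (λ z → (x + z) % n) e+[n∸e%n]≡[1+e/n]*n ⟩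
      (x + suc (e / n) * n) % n     ≡⟨ [m+kn]%n≡m%n x (suc (e / n)) n ⟩
      x % n                         ∎

  +-cancelˡ-mod : ∀ e {a b} → e + a ≡ e + b [mod n ] → a ≡ b [mod n ]
  +-cancelˡ-mod e {a} {b} h =
    +-cancelʳ-mod e (subst₂ (λ x y → x ≡ y [mod n ]) (+-comm e a) (+-comm e b) h)

  ≡-mod⇒≡ : ∀ {a b} → a < n → b < n → a ≡ b [mod n ] → a ≡ b
  ≡-mod⇒≡ a<n b<n h = trans (sym (m<n⇒m%n≡m a<n)) (trans h (m<n⇒m%n≡m b<n))

  ≡%⇒≡-mod : ∀ {a b} → a ≡ b % n → a ≡ b [mod n ]
  ≡%⇒≡-mod {a} {b} a≡b%n = trans (cong (_% n) a≡b%n) (m%n%n≡m%n b n)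

  +-offset-mod : ∀ {a} b → a ≤ n → a + (b + (n ∸ a)) % n ≡ b [mod n ]
  +-offset-mod {a} b a≤n = begin
    (a + (b + (n ∸ a)) % n) % n   ≡⟨ +-congˡ-mod a (m%n%n≡m%n (b + (n ∸ a)) n) ⟩
    (a + (b + (n ∸ a))) % n       ≡⟨ cong (_% n) (a+[b+c]≡b+[a+c] a b (n ∸ a)) ⟩
    (b + (a + (n ∸ a))) % n       ≡⟨ cong (λ z → (b + z) % n) (m+[n∸m]≡n a≤n) ⟩
    (b + n) % n                   ≡⟨ [m+n]%n≡m%n b n ⟩
    b % n                         ∎
    where
    open ≡-Reasoning
    a+[b+c]≡b+[a+c] : ∀ a b c → a + (b + c) ≡ b + (a + c)
    a+[b+c]≡b+[a+c] = solve-∀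

  toℕ-mod : ∀ a → toℕ (a mod n) ≡ a % n
  toℕ-mod a = toℕ-fromℕ< (m%n<n a n)

  mod-cong : ∀ {a b} → a ≡ b [mod n ] → a mod n ≡ b mod n
  mod-cong {a} {b} h = toℕ-injective (trans (toℕ-mod a) (trans h (sym (toℕ-mod b))))

  mod-injective : ∀ {a b} → a mod n ≡ b mod n → a ≡ b [mod n ]
  mod-injective {a} {b} h = trans (sym (toℕ-mod a)) (trans (cong toℕ h) (toℕ-mod b))

  toℕ-mod-≡ : ∀ a → toℕ (a mod n) ≡ a [mod n ]
  toℕ-mod-≡ a = ≡%⇒≡-mod (toℕ-mod a)

  mod-toℕ : (x : Fin n) → toℕ x mod n ≡ x
  mod-toℕ x = toℕ-injective (trans (toℕ-mod (toℕ x)) (m<n⇒m%n≡m (toℕ<n x)))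

⌈m/n⌉*n≤m+n∸1 : ∀ m n .{{_ : NonZero n}} → ⌈ m / n ⌉ * n ≤ m + n ∸ 1
⌈m/n⌉*n≤m+n∸1 m n = m/n*n≤m (m + n ∸ 1) n

m+n∸1<[1+⌈m/n⌉]*n : ∀ m n .{{_ : NonZero n}} → m + n ∸ 1 < suc ⌈ m / n ⌉ * n
m+n∸1<[1+⌈m/n⌉]*n m n = begin-strict
  m + n ∸ 1                                  ≡⟨ m≡m%n+[m/n]*n (m + n ∸ 1) n ⟩
  (m + n ∸ 1) % n + ⌈ m / n ⌉ * n            <⟨ +-monoˡ-< (⌈ m / n ⌉ * n) (m%n<n (m + n ∸ 1) n) ⟩
  n + ⌈ m / n ⌉ * n                          ∎
  where open ≤-Reasoning

m≤n*⌈m/n⌉ : ∀ m n .{{_ : NonZero n}} → m ≤ n * ⌈ m / n ⌉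
m≤n*⌈m/n⌉ m n@(suc n-1) = +-cancelʳ-≤ n-1 m (n * ⌈ m / n ⌉) (begin
  m + n-1                    ≡⟨ cong (_∸ 1) (+-suc m n-1) ⟨
  m + n ∸ 1                  ≤⟨ s≤s⁻¹ (m+n∸1<[1+⌈m/n⌉]*n m n) ⟩
  n-1 + ⌈ m / n ⌉ * n        ≡⟨ +-comm n-1 (⌈ m / n ⌉ * n) ⟩
  ⌈ m / n ⌉ * n + n-1        ≡⟨ cong (_+ n-1) (*-comm ⌈ m / n ⌉ n) ⟩
  n * ⌈ m / n ⌉ + n-1        ∎)
  where open ≤-Reasoning

⌈m/n⌉-least : ∀ m n o .{{_ : NonZero n}} → m ≤ o * n → ⌈ m / n ⌉ ≤ o
⌈m/n⌉-least m n@(suc n-1) o m≤o*n = s≤s⁻¹ (*-cancelʳ-< n ⌈ m / n ⌉ (suc o) (begin-strict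
  ⌈ m / n ⌉ * n      ≤⟨ ⌈m/n⌉*n≤m+n∸1 m n ⟩
  m + n ∸ 1          ≡⟨ cong (_∸ 1) (+-suc m n-1) ⟩
  m + n-1            ≤⟨ +-monoˡ-≤ n-1 m≤o*n ⟩
  o * n + n-1        <⟨ +-monoʳ-< (o * n) (n<1+n n-1) ⟩
  o * n + n          ≡⟨ +-comm (o * n) n ⟩
  suc o * n          ∎))
  where open ≤-Reasoning

⌈m/n⌉≤m : ∀ m n .{{_ : NonZero n}} → ⌈ m / n ⌉ ≤ m
⌈m/n⌉≤m m n = ⌈m/n⌉-least m n m (m≤m*n m n)

n∣m⇒⌈m/n⌉≡m/n : ∀ {m n} .{{_ : NonZero n}} → n ∣ m → ⌈ m / n ⌉ ≡ m / n
n∣m⇒⌈m/n⌉≡m/n {m} {n} n∣m = ≤-antisym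
  (⌈m/n⌉-least m n (m / n) (≤-reflexive (sym (m/n*n≡m n∣m))))
  (*-cancelˡ-≤ n (begin
    n * (m / n)       ≡⟨ m*[n/m]≡n n∣m ⟩
    m                 ≤⟨ m≤n*⌈m/n⌉ m n ⟩
    n * ⌈ m / n ⌉     ∎))
  where open ≤-Reasoning

p*[i/p]+i%p≡i : ∀ i p .{{_ : NonZero p}} → p * (i / p) + i % p ≡ i
p*[i/p]+i%p≡i i p = begin
  p * (i / p) + i % p   ≡⟨ +-comm (p * (i / p)) (i % p) ⟩
  i % p + p * (i / p)   ≡⟨ cong (_+_ (i % p)) (*-comm p (i / p)) ⟩
  i % p + i / p * p     ≡⟨ m≡m%n+[m/n]*n i p ⟨
  i                     ∎
  where open ≡-Reasoning

p*a+b<d*p : ∀ {a b d} p → a < d → b < p → p * a + b < d * p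
p*a+b<d*p {a} {b} {d} p a<d b<p = begin-strict
  p * a + b     <⟨ +-monoʳ-< (p * a) b<p ⟩
  p * a + p     ≡⟨ +-comm (p * a) p ⟩
  p + p * a     ≡⟨ *-suc p a ⟨
  p * suc a     ≤⟨ *-monoʳ-≤ p a<d ⟩
  p * d         ≡⟨ *-comm p d ⟩
  d * p         ∎
  where open ≤-Reasoning

repunit : ℕ → ℕ → ℕ
repunit d zero    = 0
repunit d (suc m) = 1 + d * repunit d m

repunit-suc : ∀ d m → repunit d (suc m) ≡ repunit d m + d ^ m
repunit-suc d zero    = cong suc (*-zeroʳ d)
repunit-suc d (suc m) = begin
  1 + d * repunit d (suc m)         ≡⟨ cong (λ r → 1 + d * r) (repunit-suc d m) ⟩
  1 + d * (repunit d m + d ^ m)     ≡⟨ cong suc (*-distribˡ-+ d (repunit d m) (d ^ m)) ⟩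
  1 + d * repunit d m + d ^ suc m   ∎
  where open ≡-Reasoning

repunit-mono : ∀ d m → repunit d m ≤ repunit d (suc m)
repunit-mono d m = subst (repunit d m ≤_) (sym (repunit-suc d m)) (m≤m+n (repunit d m) (d ^ m))

geomSum≡repunit : ∀ d k → geomSum d k ≡ repunit d (suc k)
geomSum≡repunit d zero    = cong suc (sym (*-zeroʳ d))
geomSum≡repunit d (suc k) = trans (cong (_+ d ^ suc k) (geomSum≡repunit d k)) (sym (repunit-suc d (suc k)))

bracket : ∀ (L f : ℕ → ℕ) → L 0 ≤ f 0 → (∀ m → f m ≤ f (suc m)) →
          ∀ k → f k < L (suc k) → ∃ λ m → m ≤ k × L m ≤ f m × f m < L (suc m)
bracket L f L0≤f0 f-mono zero    f0<L1 = 0 , z≤n , L0≤f0 , f0<L1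
bracket L f L0≤f0 f-mono (suc k) f<L with L (suc k) ≤? f (suc k)
... | yes L≤f = suc k , ≤-refl , L≤f , f<L
... | no  L≰f with bracket L f L0≤f0 f-mono k (≤-<-trans (f-mono k) (≰⇒> L≰f))
...   | m , m≤k , L≤f , f<L′ = m , m≤n⇒m≤1+n m≤k , L≤f , f<L′

bézout-mod : ∀ e n .{{_ : NonZero n}} → ∃ λ x → e * x ≡ gcd e n [mod n ]
bézout-mod e n@(suc n-1) with Bézout.identity (gcd-GCD e n)
... | Bézout.+- x y g+yn≡xe = x , (begin
  (e * x) % n             ≡⟨ cong (_% n) (trans (*-comm e x) (sym g+yn≡xe)) ⟩
  (gcd e n + y * n) % n   ≡⟨ [m+kn]%n≡m%n (gcd e n) y n ⟩
  gcd e n % n             ∎)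
  where open ≡-Reasoning
-- here x * (n ∸ 1) ≡ − x (mod n)
... | Bézout.-+ x y g+xe≡yn = x * n-1 , (begin
  (e * (x * n-1)) % n                    ≡⟨ [m+kn]%n≡m%n (e * (x * n-1)) y n ⟨
  (e * (x * n-1) + y * n) % n            ≡⟨ cong (λ z → (e * (x * n-1) + z) % n) g+xe≡yn ⟨
  (e * (x * n-1) + (g + x * e)) % n      ≡⟨ cong (_% n) (regroup e x n-1 g) ⟩
  (g + x * e * n) % n                    ≡⟨ [m+kn]%n≡m%n g (x * e) n ⟩
  g % n                                  ∎)
  where
  open ≡-Reasoning
  g = gcd e n
  regroup : ∀ e x m a → e * (x * m) + (a + x * e) ≡ a + x * e * (1 + m)
  regroup = solve-∀

linear-congruence : ∀ e n .{{_ : NonZero n}} {b} → gcd e n ∣ b → ∃ λ x → e * x ≡ b [mod n ]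
linear-congruence e n {b} (divides f b≡fg) with bézout-mod e n
... | x , ex≡g = x * f , (begin
  (e * (x * f)) % n    ≡⟨ cong (_% n) (regroup e x f) ⟩
  (f * (e * x)) % n    ≡⟨ *-congˡ-mod f ex≡g ⟩
  (f * gcd e n) % n    ≡⟨ cong (_% n) b≡fg ⟨
  b % n                ∎)
  where
  open ≡-Reasoning
  open Modular {n}
  regroup : ∀ e x f → e * (x * f) ≡ f * (e * x)
  regroup = solve-∀

-- c + q * (n ∸ 1) is c − q modulo n, written without truncated subtraction.
affine-congruence : ∀ e n .{{_ : NonZero n}} {c q} → gcd e n ∣ c + q * (n ∸ 1) →
                    ∃ λ (x : Fin n) → suc e * toℕ x + q ≡ toℕ x + c [mod n ]
affine-congruence e n {c} {q} g∣c+q[n-1] with linear-congruence e n g∣c+q[n-1]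
... | x₀ , ex₀≡c+q[n-1] = x₀ mod n , (begin
  (X + e * X + q) % n              ≡⟨ +-congʳ-mod q (+-congˡ-mod X (*-congˡ-mod e (toℕ-mod-≡ x₀))) ⟩
  (X + e * x₀ + q) % n             ≡⟨ +-congʳ-mod q (+-congˡ-mod X ex₀≡c+q[n-1]) ⟩
  (X + (c + q * (n ∸ 1)) + q) % n  ≡⟨ cong (_% n) (regroup X c q (n ∸ 1)) ⟩
  (X + c + q * (1 + (n ∸ 1))) % n  ≡⟨ cong (λ m → (X + c + q * m) % n) (m+[n∸m]≡n (>-nonZero⁻¹ n)) ⟩
  (X + c + q * n) % n              ≡⟨ [m+kn]%n≡m%n (X + c) q n ⟩
  (X + c) % n                      ∎)
  where
  open ≡-Reasoning
  open Modular {n}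
  X = toℕ (x₀ mod n)
  regroup : ∀ X c q m → X + (c + q * m) + q ≡ X + c + q * (1 + m)
  regroup = solve-∀

members : ∀ {n} → Subset n → List (Fin n)
members []            = []
members (inside ∷ p)  = Fin.zero ∷ map Fin.suc (members p)
members (outside ∷ p) = map Fin.suc (members p)

length-members : ∀ {n} (p : Subset n) → length (members p) ≡ ∣ p ∣
length-members []            = refl
length-members (inside ∷ p)  = cong suc (trans (length-map Fin.suc (members p)) (length-members p))
length-members (outside ∷ p) = trans (length-map Fin.suc (members p)) (length-members p)

∈-members : ∀ {n} {x : Fin n} {p} → x ∈ p → x ∈ₗ members p
∈-members {p = inside ∷ p}  here      = Any.here refl
∈-members {p = inside ∷ p}  (there h) = Any.there (∈-map⁺ Fin.suc (∈-members h))
∈-members {p = outside ∷ p} (there h) = ∈-map⁺ Fin.suc (∈-members h)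

covering⇒n≤length : ∀ {n} (ys : List (Fin n)) → (∀ v → v ∈ₗ ys) → n ≤ length ys
covering⇒n≤length ys covers = injective⇒≤ {f = λ v → Any.index (covers v)} index-injective
  where
  index-injective : ∀ {v w} → Any.index (covers v) ≡ Any.index (covers w) → v ≡ w
  index-injective {v} {w} eq = begin
    v                                  ≡⟨ lookup-index (covers v) ⟩
    List.lookup ys (Any.index (covers v)) ≡⟨ cong (List.lookup ys) eq ⟩
    List.lookup ys (Any.index (covers w)) ≡⟨ lookup-index (covers w) ⟨
    w                                  ∎
    where open ≡-Reasoning

x∉p⇒∣p∪⁅x⁆∣≡1+∣p∣ : ∀ {n} (p : Subset n) (x : Fin n) → x ∉ p → ∣ p ∪ ⁅ x ⁆ ∣ ≡ suc ∣ p ∣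
x∉p⇒∣p∪⁅x⁆∣≡1+∣p∣ (inside ∷ p)  Fin.zero    x∉p = ⊥-elim (x∉p here)
x∉p⇒∣p∪⁅x⁆∣≡1+∣p∣ (outside ∷ p) Fin.zero    x∉p = cong (suc ∘ ∣_∣) (∪-identityʳ p)
x∉p⇒∣p∪⁅x⁆∣≡1+∣p∣ (inside ∷ p)  (Fin.suc x) x∉p = cong suc (x∉p⇒∣p∪⁅x⁆∣≡1+∣p∣ p x (x∉p ∘ there))
x∉p⇒∣p∪⁅x⁆∣≡1+∣p∣ (outside ∷ p) (Fin.suc x) x∉p = x∉p⇒∣p∪⁅x⁆∣≡1+∣p∣ p x (x∉p ∘ there)

module _ {n : ℕ} .{{_ : NonZero n}} (x : Fin n) where

  open Modular {n}

  ∈-interval : ∀ {t j} → t < j → (toℕ x + t) mod n ∈ interval n x j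
  ∈-interval {t} {suc j} t<1+j with m≤n⇒m<n∨m≡n (s≤s⁻¹ t<1+j)
  ... | inj₁ t<j  = x∈p∪q⁺ (inj₁ (∈-interval t<j))
  ... | inj₂ refl = x∈p∪q⁺ (inj₂ (x∈⁅x⁆ _))

  interval-elements : ∀ {y} j → y ∈ interval n x j → ∃ λ t → t < j × y ≡ (toℕ x + t) mod n
  interval-elements zero    y∈ = ⊥-elim (∉⊥ y∈)
  interval-elements (suc j) y∈ with x∈p∪q⁻ (interval n x j) _ y∈
  ... | inj₁ y∈′ with interval-elements j y∈′
  ...   | t , t<j , y≡ = t , m≤n⇒m≤1+n t<j , y≡
  interval-elements (suc j) y∈ | inj₂ y∈⁅⁆ = j , ≤-refl , x∈⁅y⁆⇒x≡y _ y∈⁅⁆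

  ∣interval∣ : ∀ j → j ≤ n → ∣ interval n x j ∣ ≡ j
  ∣interval∣ zero    _   = ∣⊥∣≡0 n
  ∣interval∣ (suc j) j<n = begin
    ∣ interval n x j ∪ ⁅ (toℕ x + j) mod n ⁆ ∣  ≡⟨ x∉p⇒∣p∪⁅x⁆∣≡1+∣p∣ (interval n x j) _ new ⟩
    suc ∣ interval n x j ∣                      ≡⟨ cong suc (∣interval∣ j (<⇒≤ j<n)) ⟩
    suc j                                       ∎
    where
    open ≡-Reasoning
    new : (toℕ x + j) mod n ∉ interval n x j
    new x+j∈ with interval-elements j x+j∈
    ... | t , t<j , x+j≡x+t =
      <⇒≢ t<j (sym (≡-mod⇒≡ j<n (<-trans t<j j<n) (+-cancelˡ-mod (toℕ x) (mod-injective x+j≡x+t))))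

module _ {n d : ℕ} .{{_ : NonZero n}} where

  open Modular {n}

  walk-step-endpoint : ∀ {X w a} p b → w ≡ (d * X + a) % n →
                       p * w + b ≡ d * p * X + (p * a + b) [mod n ]
  walk-step-endpoint {X} {w} {a} p b w≡dX+a = begin
    (p * w + b) % n                 ≡⟨ +-congʳ-mod b (*-congˡ-mod p (≡%⇒≡-mod w≡dX+a)) ⟩
    (p * (d * X + a) + b) % n       ≡⟨ cong (_% n) (regroup p d X a b) ⟩
    (d * p * X + (p * a + b)) % n   ∎
    where
    open ≡-Reasoning
    regroup : ∀ p d X a b → p * (d * X + a) + b ≡ d * p * X + (p * a + b)
    regroup = solve-∀

  descendant : Fin n → ℕ → ℕ → Fin n
  descendant u m i = (d ^ m * toℕ u + i) mod n

  descendant-zero : ∀ u → descendant u 0 0 ≡ u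
  descendant-zero u = begin
    (1 * toℕ u + 0) mod n   ≡⟨ cong (_mod n) (+-identityʳ (1 * toℕ u)) ⟩
    (1 * toℕ u) mod n       ≡⟨ cong (_mod n) (*-identityˡ (toℕ u)) ⟩
    toℕ u mod n             ≡⟨ mod-toℕ u ⟩
    u                       ∎
    where open ≡-Reasoning

  walk-endpoint : ∀ {m u v} → Walk n d m u v → ∃ λ i → i < d ^ m × v ≡ descendant u m i
  walk-endpoint {u = u} here = 0 , s≤s z≤n , sym (descendant-zero u)
  walk-endpoint {suc m} {u} (step {w = w} (a , a<d , w≡dw+a) walk) with walk-endpoint walk
  ... | b , b<p , v≡pw+b = d ^ m * a + b , p*a+b<d*p (d ^ m) a<d b<p ,
        trans v≡pw+b (mod-cong (walk-step-endpoint (d ^ m) b w≡dw+a))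

  walk-to : .{{_ : NonZero d}} → ∀ m u i → i < d ^ m → Walk n d m u (descendant u m i)
  walk-to zero    u .0 (s≤s z≤n) = subst (Walk n d 0 u) (sym (descendant-zero u)) here
  walk-to (suc m) u i i<dp = step arc (subst (Walk n d m w) (mod-cong w-endpoint) (walk-to m w b b<p))
    where
    instance _ = m^n≢0 d m
    p = d ^ m
    a = i / p
    b = i % p
    b<p : b < p
    b<p = m%n<n i p
    w : Fin n
    w = (d * toℕ u + a) mod n
    arc : Arc n d u w
    arc = a , m<n*o⇒m/o<n i<dp , toℕ-mod (d * toℕ u + a)
    w-endpoint : p * toℕ w + b ≡ d * p * toℕ u + i [mod n ]
    w-endpoint = trans (walk-step-endpoint p b (toℕ-mod (d * toℕ u + a)))
                       (cong (λ j → (d * p * toℕ u + j) % n) (p*[i/p]+i%p≡i i p))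

  layer : Fin n → ℕ → List (Fin n)
  layer u m = applyUpTo (descendant u m) (d ^ m)

  ball : Fin n → ℕ → List (Fin n)
  ball u zero    = layer u 0
  ball u (suc k) = ball u k ++ layer u (suc k)

  length-ball : ∀ u k → length (ball u k) ≡ geomSum d k
  length-ball u zero    = length-applyUpTo (descendant u 0) 1
  length-ball u (suc k) = begin
    length (ball u k ++ layer u (suc k))           ≡⟨ length-++ (ball u k) ⟩
    length (ball u k) + length (layer u (suc k))   ≡⟨ cong₂ _+_ (length-ball u k)
                                                         (length-applyUpTo (descendant u (suc k)) (d ^ suc k)) ⟩
    geomSum d k + d ^ suc k                        ∎
    where open ≡-Reasoning

  walk⇒∈-ball : ∀ {k m u v} → m ≤ k → Walk n d m u v → v ∈ₗ ball u k
  walk⇒∈-ball {k} {m} {u} m≤k walk with walk-endpoint walk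
  ... | i , i<dᵐ , refl = ∈-ball k m≤k
    where
    ∈-ball : ∀ k → m ≤ k → descendant u m i ∈ₗ ball u k
    ∈-ball zero    z≤n = ∈-applyUpTo⁺ (descendant u 0) i<dᵐ
    ∈-ball (suc k) m≤1+k with m≤n⇒m<n∨m≡n m≤1+k
    ... | inj₁ m<1+k = ∈-++⁺ˡ (∈-ball k (s≤s⁻¹ m<1+k))
    ... | inj₂ refl  = ∈-++⁺ʳ (ball u k) (∈-applyUpTo⁺ (descendant u m) i<dᵐ)

  dominating⇒n≤∣D∣*geomSum : ∀ k D → IsDistDom n d k D → n ≤ ∣ D ∣ * geomSum d k
  dominating⇒n≤∣D∣*geomSum k D dom = begin
    n                                           ≤⟨ covering⇒n≤length (concatMap (λ u → ball u k) (members D)) covered ⟩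
    length (concatMap (λ u → ball u k) (members D)) ≡⟨ length-balls (members D) ⟩
    length (members D) * geomSum d k            ≡⟨ cong (_* geomSum d k) (length-members D) ⟩
    ∣ D ∣ * geomSum d k                         ∎
    where
    open ≤-Reasoning
    length-balls : ∀ us → length (concatMap (λ u → ball u k) us) ≡ length us * geomSum d k
    length-balls []       = refl
    length-balls (u ∷ us) = trans (length-++ (ball u k)) (cong₂ _+_ (length-ball u k) (length-balls us))
    dominated : ∀ v → ∃ λ u → u ∈ D × ∃ λ m → m ≤ k × Walk n d m u v
    dominated v with v ∈? D
    ... | yes v∈D = v , v∈D , 0 , z≤n , here
    ... | no  v∉D = dom v v∉D
    covered : ∀ v → v ∈ₗ concatMap (λ u → ball u k) (members D)
    covered v with dominated v
    ... | u , u∈D , m , m≤k , walk =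
      ∈-concatMap⁺ (λ u → ball u k) (lose {P = λ u → v ∈ₗ ball u k} (∈-members u∈D) (walk⇒∈-ball m≤k walk))

  module _ .{{_ : NonZero d}} (x : Fin n) (c : ℕ) where

    interval-reaches : ∀ m r → r < c * d ^ m →
                       ∃ λ u → u ∈ interval n x c × Walk n d m u (descendant x m r)
    interval-reaches m r r<cp =
      u , ∈-interval x (m<n*o⇒m/o<n {r} {c} {p} r<cp) ,
      subst (Walk n d m u) (mod-cong endpoint) (walk-to m u (r % p) (m%n<n r p))
      where
      instance _ = m^n≢0 d m
      p = d ^ m
      u : Fin n
      u = (toℕ x + r / p) mod n
      endpoint : p * toℕ u + r % p ≡ p * toℕ x + r [mod n ]
      endpoint = begin
        (p * toℕ u + r % p) % n                  ≡⟨ +-congʳ-mod (r % p) (*-congˡ-mod p (toℕ-mod-≡ (toℕ x + r / p))) ⟩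
        (p * (toℕ x + r / p) + r % p) % n        ≡⟨ cong (_% n) (regroup p (toℕ x) (r / p) (r % p)) ⟩
        (p * toℕ x + (p * (r / p) + r % p)) % n  ≡⟨ cong (λ z → (p * toℕ x + z) % n) (p*[i/p]+i%p≡i r p) ⟩
        (p * toℕ x + r) % n                      ∎
        where
        open ≡-Reasoning
        regroup : ∀ p X j i → p * (X + j) + i ≡ p * X + (p * j + i)
        regroup = solve-∀

    module _ {q : ℕ} (key : d * toℕ x + q ≡ toℕ x + c [mod n ]) where

      orbit : ∀ m → d ^ m * toℕ x + q * repunit d m ≡ toℕ x + c * repunit d m [mod n ]
      orbit zero    = cong (_% n) (base (toℕ x) q c)
        where
        base : ∀ X q c → 1 * X + q * 0 ≡ X + c * 0
        base = solve-∀
      orbit (suc m) = begin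
        (d * d ^ m * X + q * (1 + d * R)) % n   ≡⟨ cong (_% n) (regroup₁ d (d ^ m) X q R) ⟩
        (d * (d ^ m * X + q * R) + q) % n       ≡⟨ +-congʳ-mod q (*-congˡ-mod d (orbit m)) ⟩
        (d * (X + c * R) + q) % n               ≡⟨ cong (_% n) (regroup₂ d X c R q) ⟩
        (d * X + q + c * (d * R)) % n           ≡⟨ +-congʳ-mod (c * (d * R)) key ⟩
        (X + c + c * (d * R)) % n               ≡⟨ cong (_% n) (regroup₃ d X c R) ⟩
        (X + c * (1 + d * R)) % n               ∎
        where
        open ≡-Reasoning
        X = toℕ x
        R = repunit d m
        regroup₁ : ∀ d p X q R → d * p * X + q * (1 + d * R) ≡ d * (p * X + q * R) + q
        regroup₁ = solve-∀
        regroup₂ : ∀ d X c R q → d * (X + c * R) + q ≡ d * X + q + c * (d * R)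
        regroup₂ = solve-∀
        regroup₃ : ∀ d X c R → X + c + c * (d * R) ≡ X + c * (1 + d * R)
        regroup₃ = solve-∀

      orbit-offset : ∀ {m t} → c * repunit d m ≤ t + q * repunit d m →
                     d ^ m * toℕ x + (t + q * repunit d m ∸ c * repunit d m) ≡ toℕ x + t [mod n ]
      orbit-offset {m} {t} cR≤t+qR = +-cancelʳ-mod (q * R) (begin
        (d ^ m * X + r + q * R) % n    ≡⟨ cong (_% n) (swap (d ^ m * X) r (q * R)) ⟩
        (d ^ m * X + q * R + r) % n    ≡⟨ +-congʳ-mod r (orbit m) ⟩
        (X + c * R + r) % n            ≡⟨ cong (_% n) (+-assoc X (c * R) r) ⟩
        (X + (c * R + r)) % n          ≡⟨ cong (λ z → (X + z) % n) (m+[n∸m]≡n cR≤t+qR) ⟩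
        (X + (t + q * R)) % n          ≡⟨ cong (_% n) (+-assoc X t (q * R)) ⟨
        (X + t + q * R) % n            ∎)
        where
        open ≡-Reasoning
        X = toℕ x
        R = repunit d m
        r = t + q * R ∸ c * R
        swap : ∀ a b c → a + b + c ≡ a + c + b
        swap = solve-∀

      interval-dominates : ∀ k → q * repunit d k + n ≤ c * repunit d (suc k) → IsDistDom n d k (interval n x c)
      interval-dominates k qRₖ+n≤cRₖ₊₁ v _ =
        let m , m≤k , lo , hi = bracket (λ m → c * R m) f cR₀≤f₀ f-mono k fₖ<cRₖ₊₁
            u , u∈ , walk     = reach m lo hi
        in  u , u∈ , m , m≤k , walk
        where
        R = repunit d
        t = (toℕ v + (n ∸ toℕ x)) % n
        f : ℕ → ℕ
        f m = t + q * R m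
        cR₀≤f₀ : c * R 0 ≤ f 0
        cR₀≤f₀ = subst (_≤ f 0) (sym (*-zeroʳ c)) z≤n
        f-mono : ∀ m → f m ≤ f (suc m)
        f-mono m = +-monoʳ-≤ t (*-monoʳ-≤ q (repunit-mono d m))
        fₖ<cRₖ₊₁ : f k < c * R (suc k)
        fₖ<cRₖ₊₁ = begin-strict
          t + q * R k    <⟨ +-monoˡ-< (q * R k) (m%n<n (toℕ v + (n ∸ toℕ x)) n) ⟩
          n + q * R k    ≡⟨ +-comm n (q * R k) ⟩
          q * R k + n    ≤⟨ qRₖ+n≤cRₖ₊₁ ⟩
          c * R (suc k)  ∎
          where open ≤-Reasoning
        reach : ∀ m → c * R m ≤ f m → f m < c * R (suc m) → ∃ λ u → u ∈ interval n x c × Walk n d m u v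
        reach m lo hi = subst (λ w → ∃ λ u → u ∈ interval n x c × Walk n d m u w) reaches-v
                          (interval-reaches m (f m ∸ c * R m) r<cdᵐ)
          where
          cRₘ₊₁≡cRₘ+cdᵐ : c * R (suc m) ≡ c * R m + c * d ^ m
          cRₘ₊₁≡cRₘ+cdᵐ = trans (cong (c *_) (repunit-suc d m)) (*-distribˡ-+ c (R m) (d ^ m))
          r<cdᵐ : f m ∸ c * R m < c * d ^ m
          r<cdᵐ = subst (f m ∸ c * R m <_)
                    (trans (cong (_∸ c * R m) cRₘ₊₁≡cRₘ+cdᵐ) (m+n∸m≡n (c * R m) (c * d ^ m)))
                    (∸-monoˡ-< hi lo)
          reaches-v : descendant x m (f m ∸ c * R m) ≡ v
          reaches-v = trans (mod-cong (trans (orbit-offset {m} lo) (+-offset-mod (toℕ v) (<⇒≤ (toℕ<n x)))))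
                            (mod-toℕ v)

IntervalCondition : (d n k : ℕ) .{{_ : NonZero n}} → Set
IntervalCondition d n k =
  ((geomSum d k ∣ n) × (gcd (d ∸ 1) n ∣ n / geomSum d k))
  ⊎ (∃ λ (q : ℤ) →
       (+ gcd (d ∸ 1) n) ∣ℤ (+ ⌈ n / geomSum d k ⌉ - q)
       × + 0 ≤ℤ q *ℤ + geomSum d (k ∸ 1)
       × q *ℤ + geomSum d (k ∸ 1) ≤ℤ + (geomSum d k * ⌈ n / geomSum d k ⌉) - + n)

+a≤+b-+c⇒a+c≤b : ∀ {a b c} → + a ≤ℤ + b - + c → a + c ≤ b
+a≤+b-+c⇒a+c≤b {a} {b} {c} a≤b-c = ℤ.drop‿+≤+ (begin
  + a ℤ.+ + c          ≤⟨ ℤ.+-monoˡ-≤ (+ c) a≤b-c ⟩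
  + b - + c ℤ.+ + c    ≡⟨ cancel (+ b) (+ c) ⟩
  + b                  ∎)
  where
  open ℤ.≤-Reasoning
  cancel : ∀ b c → b - c ℤ.+ c ≡ b
  cancel = ℤ-solve-∀

g∣c-q⇒g∣c+q[n-1] : ∀ {g c q n} .{{_ : NonZero n}} → g ∣ n → + g ∣ℤ + c - + q → g ∣ c + q * (n ∸ 1)
g∣c-q⇒g∣c+q[n-1] {g} {c} {q} {n} g∣n g∣c-q =
  Signed.∣⇒∣ᵤ (subst (Signed._∣_ (+ g)) (sym c+q[n-1]≡[c-q]+qn) g∣[c-q]+qn)
  where
  open ≡-Reasoning
  g∣[c-q]+qn : Signed._∣_ (+ g) (+ c - + q ℤ.+ + q *ℤ + n)
  g∣[c-q]+qn = Signed.∣m∣n⇒∣m+n {m = + c - + q} (Signed.∣ᵤ⇒∣ g∣c-q) (Signed.∣n⇒∣m*n (+ q) (Signed.∣ᵤ⇒∣ g∣n))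
  regroup : ∀ c q m → c ℤ.+ q *ℤ m ≡ c - q ℤ.+ q *ℤ (ℤ.1ℤ ℤ.+ m)
  regroup = ℤ-solve-∀
  c+q[n-1]≡[c-q]+qn : + (c + q * (n ∸ 1)) ≡ + c - + q ℤ.+ + q *ℤ + n
  c+q[n-1]≡[c-q]+qn = begin
    + (c + q * (n ∸ 1))                  ≡⟨ ℤ.pos-+ c (q * (n ∸ 1)) ⟩
    + c ℤ.+ + (q * (n ∸ 1))              ≡⟨ cong (ℤ._+_ (+ c)) (ℤ.pos-* q (n ∸ 1)) ⟩
    + c ℤ.+ + q *ℤ + (n ∸ 1)             ≡⟨ regroup (+ c) (+ q) (+ (n ∸ 1)) ⟩
    + c - + q ℤ.+ + q *ℤ + (1 + (n ∸ 1)) ≡⟨ cong (λ m → + c - + q ℤ.+ + q *ℤ + m) (m+[n∸m]≡n (>-nonZero⁻¹ n)) ⟩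
    + c - + q ℤ.+ + q *ℤ + n             ∎

-- Under (ii) the shift q is nonnegative because geomSum is positive; under (i) take q = 0.
admissible-shift : ∀ d n k .{{_ : NonZero n}} → IntervalCondition d n (suc k) →
  ∃ λ q → gcd (d ∸ 1) n ∣ ⌈ n / geomSum d (suc k) ⌉ + q * (n ∸ 1)
        × q * geomSum d k + n ≤ geomSum d (suc k) * ⌈ n / geomSum d (suc k) ⌉
admissible-shift d n k (inj₁ (S∣n , g∣n/S)) =
  0 , subst (gcd (d ∸ 1) n ∣_) (trans (sym (n∣m⇒⌈m/n⌉≡m/n S∣n)) (sym (+-identityʳ _))) g∣n/S ,
  m≤n*⌈m/n⌉ n (geomSum d (suc k))
admissible-shift d n k (inj₂ (-[1+ _ ] , _ , () , _))
admissible-shift d n k (inj₂ (+ q , g∣c-q , _ , qs≤Sc-n)) =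
  q , g∣c-q⇒g∣c+q[n-1] {c = ⌈ n / geomSum d (suc k) ⌉} {q} (gcd[m,n]∣n (d ∸ 1) n) g∣c-q ,
  +a≤+b-+c⇒a+c≤b (subst (_≤ℤ _) (sym (ℤ.pos-* q (geomSum d k))) qs≤Sc-n)

geomSum-bound⇒repunit-bound : ∀ d k q n c → q * geomSum d k + n ≤ geomSum d (suc k) * c →
                              q * repunit d (suc k) + n ≤ c * repunit d (suc (suc k))
geomSum-bound⇒repunit-bound d k q n c =
  subst₂ _≤_ (cong (λ r → q * r + n) (geomSum≡repunit d k))
             (trans (*-comm (geomSum d (suc k)) c) (cong (c *_) (geomSum≡repunit d (suc k))))

dominating-interval⇒minimum : ∀ {n d k c} .{{_ : NonZero n}} (x : Fin n) → c ≤ n →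
  IsDistDom n d k (interval n x c) → (∀ D → IsDistDom n d k D → c ≤ ∣ D ∣) →
  DomNumberIs n d k c × ∃ λ (x : Fin n) → IsMinDistDom n d k (interval n x c) × ∣ interval n x c ∣ ≡ c
dominating-interval⇒minimum {c = c} x c≤n dom lower =
  ((interval _ x c , dom , ∣interval∣ x c c≤n) , lower) ,
  x , (dom , λ D dom′ → subst (_≤ ∣ D ∣) (sym (∣interval∣ x c c≤n)) (lower D dom′)) , ∣interval∣ x c c≤n

theorem2p3 : (d n k : ℕ) .{{_ : NonZero n}} → 2 ≤ d → d ≤ n → 1 ≤ k →
    (((geomSum d k ∣ n) × (gcd (d ∸ 1) n ∣ n / geomSum d k))
     ⊎ (∃ λ (q : ℤ) →
          (+ gcd (d ∸ 1) n) ∣ℤ (+ ⌈ n / geomSum d k ⌉ - q)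
          × + 0 ≤ℤ q *ℤ + geomSum d (k ∸ 1)
          × q *ℤ + geomSum d (k ∸ 1)
              ≤ℤ + (geomSum d k * ⌈ n / geomSum d k ⌉) - + n)) →
    DomNumberIs n d k ⌈ n / geomSum d k ⌉
    × ∃ λ (x : Fin n) →
        IsMinDistDom n d k (interval n x ⌈ n / geomSum d k ⌉)
        × ∣ interval n x ⌈ n / geomSum d k ⌉ ∣ ≡ ⌈ n / geomSum d k ⌉
theorem2p3 d@(suc e) n k@(suc k₀) (s≤s _) _ (s≤s z≤n) condition
  with q , g∣c+q[n-1] , qSₖ₋₁+n≤Sc ← admissible-shift d n k₀ condition
  with x , key ← affine-congruence e n {q = q} g∣c+q[n-1]
  = dominating-interval⇒minimum x (⌈m/n⌉≤m n (geomSum d k))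
      (interval-dominates x c key k (geomSum-bound⇒repunit-bound d k₀ q n c qSₖ₋₁+n≤Sc))
      (λ D dom → ⌈m/n⌉-least n (geomSum d k) ∣ D ∣ (dominating⇒n≤∣D∣*geomSum k D dom))
  where
  c = ⌈ n / geomSum d k ⌉
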